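{- Let $a(n)$ be an automatic sequence and $\alpha$ a letter such that the density of $\{n:a(n)=\alpha\}$ exists and equals $0$. Then the upper Banach density $\limsup_{N-M\to\infty}\frac{\#\{M\le n\le N:a(n)=\alpha\}}{N-M+1}$ is also $0$.
   Context: A sequence is automatic if for some $k\ge2$ it is produced by a finite automaton reading the base-$k$ expansion of $n$: $a(n)=\tau(\delta(q_0,(n)_k))$. -}

module Defs where

open import Data.Nat using (ℕ; zero; suc; _+_; _*_; _≤_; _/_; _%_)
open import Data.Nat.DivMod using (m%n<n)
open import Data.Fin using (Fin; fromℕ<)
open import Data.List using (List; []; _∷_; reverse; foldl; filter; map; length; upTo)
open import Data.Product using (Σ; ∃)
open import Relation.Binary.Definitions using (DecidableEquality)
open import Relation.Binary.PropositionalEquality using (_≡_)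

-- Base-(2+b) digits of n, least significant digit first, no leading zeros
-- (0 has the empty expansion).  The first argument is fuel (n suffices).
lsdDigits : (b : ℕ) → ℕ → ℕ → List (Fin (suc (suc b)))
lsdDigits b zero    _       = []
lsdDigits b (suc f) zero    = []
lsdDigits b (suc f) (suc n) =
  fromℕ< (m%n<n (suc n) (suc (suc b))) ∷ lsdDigits b f (suc n / suc (suc b))

expansion : (b : ℕ) → ℕ → List (Fin (suc (suc b)))
expansion b n = reverse (lsdDigits b n n)

record DFAO (k : ℕ) (A : Set) : Set where
  field
    nStates : ℕ
    δ       : Fin nStates → Fin k → Fin nStates
    q₀      : Fin nStates
    τ       : Fin nStates → A

runDFAO : {A : Set} (b : ℕ) → DFAO (suc (suc b)) A → ℕ → A
runDFAO b M n = τ (foldl δ q₀ (expansion b n))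
  where open DFAO M

Automatic : {A : Set} → (ℕ → A) → Set
Automatic {A} a = Σ ℕ λ b → Σ (DFAO (suc (suc b)) A) λ M → ∀ n → a n ≡ runDFAO b M n

countIn : {A : Set} → DecidableEquality A → (ℕ → A) → A → ℕ → ℕ → ℕ
countIn _≟_ a α M L = length (filter (λ n → a n ≟ α) (map (M +_) (upTo L)))

-- The density of {n : a(n) = α} exists and equals 0:
-- for every ε = 1/(m+1), eventually #{0 ≤ n < N : a(n)=α} ≤ ε N.
DensityZero : {A : Set} → DecidableEquality A → (ℕ → A) → A → Set
DensityZero _≟_ a α =
  ∀ (m : ℕ) → ∃ λ N₀ → ∀ N → N₀ ≤ N → countIn _≟_ a α 0 N * suc m ≤ N

-- Upper Banach density is 0: for every ε = 1/(m+1), for all windows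
-- [M, M+L-1] of length L large enough, #{..: a(n)=α} ≤ ε L.
UpperBanachDensityZero : {A : Set} → DecidableEquality A → (ℕ → A) → A → Set
UpperBanachDensityZero _≟_ a α =
  ∀ (m : ℕ) → ∃ λ L₀ → ∀ M L → L₀ ≤ L → countIn _≟_ a α M L * suc m ≤ L

-- Reading x·kⁱ + r with r < kⁱ means reading x and then the i digits of r padded with
-- zeros, so the state it reaches depends only on the state reached by x and on r.  Applied
-- to the prefixes n, ⌊n/k⌋, ⌊n/k²⌋, … together with the pigeonhole principle, this shows that
-- every state is reached by some 1 ≤ n < P = k^(number of states).  Hence, for K a power of
-- k, every aligned block [xK, xK + K) carries the same letters as one of the first P blocks,
-- all of which lie in [0, PK).  The density hypothesis with ε/(2P) at PK then bounds the
-- number of α's in every aligned block by εK/2, and a window of length L ≥ 2K is covered by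
-- L/K + 2 ≤ 2L/K aligned blocks.
module Submission where

open import Defs
open import Data.Nat
open import Data.Nat.Properties
open import Data.Nat.DivMod
open import Data.Nat.Divisibility using (divides)
open import Data.Nat.Induction using (<-rec)
open import Data.Nat.Tactic.RingSolver using (solve-∀)
open import Data.Fin using (Fin; fromℕ<; toℕ)
open import Data.Fin.Properties using (fromℕ<-cong; pigeonhole; toℕ<n)
open import Data.List using (_∷_; _++_; _∷ʳ_; reverse; foldl; filter; map; length; upTo; applyUpTo)
open import Data.List.Properties using (map-++; map-cong; map-∘; map-upTo; filter-++; length-++; foldl-∷ʳ; unfold-reverse)
open import Data.Product using (∃; _×_; _,_)
open import Relation.Binary.Definitions using (DecidableEquality)
open import Relation.Binary.PropositionalEquality
open import Relation.Nullary using (yes; no; contradiction)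
open import Function using (_∘_; id)

applyUpTo-++ : ∀ {A : Set} (f : ℕ → A) m n →
               applyUpTo f (m + n) ≡ applyUpTo f m ++ applyUpTo (f ∘ (m +_)) n
applyUpTo-++ f zero    n = refl
applyUpTo-++ f (suc m) n = cong (f 0 ∷_) (applyUpTo-++ (f ∘ suc) m n)

upTo-+ : ∀ m n → upTo (m + n) ≡ upTo m ++ map (m +_) (upTo n)
upTo-+ m n = trans (applyUpTo-++ id m n) (cong (upTo m ++_) (sym (map-upTo (m +_) n)))

n<m^n : ∀ {m} .{{_ : NonZero m}} → 1 < m → ∀ n → n < m ^ n
n<m^n 1<m zero    = z<s
n<m^n {m} 1<m (suc n) = begin-strict
  suc n       ≤⟨ n<m^n 1<m n ⟩
  m ^ n       <⟨ m<m*n (m ^ n) m {{m^n≢0 m n}} 1<m ⟩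
  m ^ n * m   ≡⟨ *-comm (m ^ n) m ⟩
  m ^ suc n   ∎
  where open ≤-Reasoning

BlocksAmongFirst : {A : Set} → (ℕ → A) → ℕ → ℕ → Set
BlocksAmongFirst a P K =
  ∀ x → ∃ λ x' → x' < P × (∀ r → r < K → a (x * K + r) ≡ a (x' * K + r))

module Counting {A : Set} (_≟_ : DecidableEquality A) (a : ℕ → A) (α : A) where

  count : ℕ → ℕ → ℕ
  count = countIn _≟_ a α

  count-+ : ∀ M m n → count M (m + n) ≡ count M m + count (M + m) n
  count-+ M m n = begin
      length (filter P? (map (M +_) (upTo (m + n))))
    ≡⟨ cong (length ∘ filter P? ∘ map (M +_)) (upTo-+ m n) ⟩
      length (filter P? (map (M +_) (upTo m ++ map (m +_) (upTo n))))
    ≡⟨ cong (length ∘ filter P?) (map-++ (M +_) (upTo m) _) ⟩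
      length (filter P? (map (M +_) (upTo m) ++ map (M +_) (map (m +_) (upTo n))))
    ≡⟨ cong length (filter-++ P? (map (M +_) (upTo m)) _) ⟩
      length (filter P? (map (M +_) (upTo m)) ++ filter P? (map (M +_) (map (m +_) (upTo n))))
    ≡⟨ length-++ (filter P? (map (M +_) (upTo m))) ⟩
      count M m + length (filter P? (map (M +_) (map (m +_) (upTo n))))
    ≡⟨ cong (λ xs → count M m + length (filter P? xs)) shift ⟩
      count M m + count (M + m) n
    ∎
    where
    open ≡-Reasoning
    P? = λ n → a n ≟ α
    shift : map (M +_) (map (m +_) (upTo n)) ≡ map ((M + m) +_) (upTo n)
    shift = trans (sym (map-∘ (upTo n))) (map-cong (λ r → sym (+-assoc M m r)) (upTo n))

  count-one-cong : ∀ {M M'} → a (M + 0) ≡ a (M' + 0) → count M 1 ≡ count M' 1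
  count-one-cong {M} {M'} eq with a (M + 0) ≟ α | a (M' + 0) ≟ α
  ... | yes _  | yes _  = refl
  ... | no _   | no _   = refl
  ... | yes p  | no ¬p  = contradiction (trans (sym eq) p) ¬p
  ... | no ¬p  | yes p  = contradiction (trans eq p) ¬p

  count-cong : ∀ {M M'} L → (∀ r → r < L → a (M + r) ≡ a (M' + r)) → count M L ≡ count M' L
  count-cong zero _ = refl
  count-cong {M} {M'} (suc L) same = begin
    count M (1 + L)                  ≡⟨ count-+ M 1 L ⟩
    count M 1 + count (M + 1) L      ≡⟨ cong₂ _+_ (count-one-cong (same 0 z<s)) (count-cong L same′) ⟩
    count M' 1 + count (M' + 1) L    ≡⟨ count-+ M' 1 L ⟨
    count M' (1 + L)                 ∎
    where
    open ≡-Reasoning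
    same′ : ∀ r → r < L → a (M + 1 + r) ≡ a (M' + 1 + r)
    same′ r r<L = trans (cong a (+-assoc M 1 r))
                        (trans (same (suc r) (s<s r<L)) (cong a (sym (+-assoc M' 1 r))))

  count-mono : ∀ {M L M' L'} → M' ≤ M → M + L ≤ M' + L' → count M L ≤ count M' L'
  count-mono {M} {L} {M'} {L'} M'≤M end≤ = begin
      count M L
    ≡⟨ cong (λ u → count u L) (m+[n∸m]≡n M'≤M) ⟨
      count (M' + d) L
    ≤⟨ m≤m+n (count (M' + d) L) _ ⟩
      count (M' + d) L + count (M' + d + L) e
    ≤⟨ m≤n+m _ (count M' d) ⟩
      count M' d + (count (M' + d) L + count (M' + d + L) e)
    ≡⟨ cong (count M' d +_) (count-+ (M' + d) L e) ⟨
      count M' d + count (M' + d) (L + e)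
    ≡⟨ count-+ M' d (L + e) ⟨
      count M' (d + (L + e))
    ≡⟨ cong (count M') (trans (sym (+-assoc d L e)) (m+[n∸m]≡n inner≤)) ⟩
      count M' L'
    ∎
    where
    open ≤-Reasoning
    d = M ∸ M'
    inner≤ : d + L ≤ L'
    inner≤ = +-cancelˡ-≤ M' (d + L) L'
               (subst (_≤ M' + L') (trans (cong (_+ L) (sym (m+[n∸m]≡n M'≤M))) (+-assoc M' d L)) end≤)
    e = L' ∸ (d + L)

  count-alignedBlock : ∀ {P K N₀ c} → BlocksAmongFirst a P K → N₀ ≤ K →
                       (∀ N → N₀ ≤ N → count 0 N * suc (c * P) ≤ N) →
                       ∀ x → count (x * K) K * c ≤ K
  count-alignedBlock {P} {K} {N₀} {c} among N₀≤K dense x with among x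
  ... | x' , x'<P , same = *-cancelʳ-≤ (count (x * K) K * c) K P (begin
      count (x * K) K * c * P
    ≡⟨ cong (λ u → u * c * P) (count-cong K same) ⟩
      count (x' * K) K * c * P
    ≡⟨ *-assoc (count (x' * K) K) c P ⟩
      count (x' * K) K * (c * P)
    ≤⟨ *-monoˡ-≤ (c * P) (count-mono {L = K} z≤n (subst (_≤ P * K) (+-comm K (x' * K)) (*-monoˡ-≤ K x'<P))) ⟩
      count 0 (P * K) * (c * P)
    ≤⟨ *-monoʳ-≤ (count 0 (P * K)) (n≤1+n (c * P)) ⟩
      count 0 (P * K) * suc (c * P)
    ≤⟨ dense (P * K) (≤-trans N₀≤K (m≤n*m K P)) ⟩
      P * K
    ≡⟨ *-comm P K ⟩
      K * P
    ∎)
    where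
    open ≤-Reasoning
    instance
      P-nonZero : NonZero P
      P-nonZero = >-nonZero (≤-<-trans z≤n x'<P)

  count-alignedRun : ∀ {K c} → (∀ x → count (x * K) K * c ≤ K) →
                     ∀ t q → count (q * K) (t * K) * c ≤ t * K
  count-alignedRun         block zero    q = z≤n
  count-alignedRun {K} {c} block (suc t) q = begin
      count (q * K) (K + t * K) * c
    ≡⟨ cong (_* c) (count-+ (q * K) K (t * K)) ⟩
      (count (q * K) K + count (q * K + K) (t * K)) * c
    ≡⟨ cong (λ u → (count (q * K) K + count u (t * K)) * c) (+-comm (q * K) K) ⟩
      (count (q * K) K + count (suc q * K) (t * K)) * c
    ≡⟨ *-distribʳ-+ c (count (q * K) K) _ ⟩
      count (q * K) K * c + count (suc q * K) (t * K) * c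
    ≤⟨ +-mono-≤ (block q) (count-alignedRun block t (suc q)) ⟩
      K + t * K
    ∎
    where open ≤-Reasoning

  count-window : ∀ {K e} .{{_ : NonZero K}} → (∀ x → count (x * K) K * (2 * e) ≤ K) →
                 ∀ M L → 2 * K ≤ L → count M L * e ≤ L
  count-window {K} {e} block M L 2K≤L = *-cancelˡ-≤ 2 (begin
      2 * (count M L * e)
    ≡⟨ *-left-swap 2 (count M L) e ⟩
      count M L * (2 * e)
    ≤⟨ *-monoˡ-≤ (2 * e) (count-mono {L = L} (m/n*n≤m M K) covered) ⟩
      count (M / K * K) (t * K) * (2 * e)
    ≤⟨ count-alignedRun block t (M / K) ⟩
      t * K
    ≡⟨ *-distribʳ-+ K (L / K) 2 ⟩
      L / K * K + 2 * K
    ≤⟨ +-mono-≤ (m/n*n≤m L K) 2K≤L ⟩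
      L + L
    ≡⟨ cong (L +_) (+-identityʳ L) ⟨
      2 * L
    ∎)
    where
    open ≤-Reasoning
    t = L / K + 2
    *-left-swap : ∀ x y z → x * (y * z) ≡ y * (x * z)
    *-left-swap = solve-∀
    covered : M + L ≤ M / K * K + t * K
    covered = begin
        M + L
      ≡⟨ cong₂ _+_ (m≡m%n+[m/n]*n M K) (m≡m%n+[m/n]*n L K) ⟩
        (M % K + M / K * K) + (L % K + L / K * K)
      ≤⟨ +-mono-≤ (+-monoˡ-≤ _ (<⇒≤ (m%n<n M K))) (+-monoˡ-≤ _ (<⇒≤ (m%n<n L K))) ⟩
        (K + M / K * K) + (K + L / K * K)
      ≡⟨ regroup K (M / K) (L / K) ⟩
        M / K * K + t * K
      ∎
      where
      regroup : ∀ k q l → (k + q * k) + (k + l * k) ≡ q * k + (l + 2) * k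
      regroup = solve-∀

module AutomatonState (b : ℕ) {A : Set} (D : DFAO (suc (suc b)) A) where
  open DFAO D

  k : ℕ
  k = suc (suc b)

  1<k : 1 < k
  1<k = s<s z<s

  k^-nonZero : ∀ i → NonZero (k ^ i)
  k^-nonZero i = m^n≢0 k i

  state : ℕ → Fin nStates
  state n = foldl δ q₀ (expansion b n)

  digit : ℕ → Fin k
  digit n = fromℕ< (m%n<n n k)

  lsdDigits-fuel : ∀ f g n → n ≤ f → n ≤ g → lsdDigits b f n ≡ lsdDigits b g n
  lsdDigits-fuel zero    zero    zero    _ _ = refl
  lsdDigits-fuel zero    (suc g) zero    _ _ = refl
  lsdDigits-fuel (suc f) zero    zero    _ _ = refl
  lsdDigits-fuel (suc f) (suc g) zero    _ _ = refl
  lsdDigits-fuel (suc f) (suc g) (suc n) n<f n<g =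
    cong (digit (suc n) ∷_) (lsdDigits-fuel f g (suc n / k) (quotient≤ n<f) (quotient≤ n<g))
    where
    quotient≤ : ∀ {h} → suc n ≤ suc h → suc n / k ≤ h
    quotient≤ n<h = ≤-trans (<⇒≤pred (m/n<m (suc n) k 1<k)) (s≤s⁻¹ n<h)

  expansion-suc : ∀ n → expansion b (suc n) ≡ expansion b (suc n / k) ∷ʳ digit (suc n)
  expansion-suc n = begin
      reverse (digit (suc n) ∷ lsdDigits b n (suc n / k))
    ≡⟨ unfold-reverse (digit (suc n)) (lsdDigits b n (suc n / k)) ⟩
      reverse (lsdDigits b n (suc n / k)) ∷ʳ digit (suc n)
    ≡⟨ cong (λ ds → reverse ds ∷ʳ digit (suc n)) (lsdDigits-fuel n (suc n / k) (suc n / k) quotient≤ ≤-refl) ⟩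
      reverse (lsdDigits b (suc n / k) (suc n / k)) ∷ʳ digit (suc n)
    ∎
    where
    open ≡-Reasoning
    quotient≤ : suc n / k ≤ n
    quotient≤ = <⇒≤pred (m/n<m (suc n) k 1<k)

  state-step : ∀ {n} → 1 ≤ n → state n ≡ δ (state (n / k)) (digit n)
  state-step {suc n} _ =
    trans (cong (foldl δ q₀) (expansion-suc n)) (foldl-∷ʳ δ q₀ (digit (suc n)) (expansion b (suc n / k)))

  runPadded : Fin nStates → ℕ → ℕ → Fin nStates
  runPadded q zero    r = q
  runPadded q (suc i) r = δ (runPadded q i (r / k)) (digit r)

  -- 1 ≤ x is essential: 0 has the empty expansion, so its padding zeros would be leading zeros.
  state-append : ∀ i {x r} → 1 ≤ x → r < k ^ i → state (x * k ^ i + r) ≡ runPadded (state x) i r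
  state-append zero {x} {zero}  _ _         = cong state (trans (+-identityʳ (x * 1)) (*-identityʳ x))
  state-append zero {r = suc r} _ (s≤s ())
  state-append (suc i) {x} {r} 1≤x r<k^i+1 = begin
      state n
    ≡⟨ state-step 1≤n ⟩
      δ (state (n / k)) (digit n)
    ≡⟨ cong₂ (λ m d → δ (state m) d) quotient (fromℕ<-cong _ _ remainder _ _) ⟩
      δ (state (x * k ^ i + r / k)) (digit r)
    ≡⟨ cong (λ q → δ q (digit r)) (state-append i 1≤x (m<n*o⇒m/o<n (subst (r <_) (*-comm k (k ^ i)) r<k^i+1))) ⟩
      runPadded (state x) (suc i) r
    ∎
    where
    open ≡-Reasoning
    instance _ = k^-nonZero (suc i)
    n = x * k ^ suc i + r
    high = x * k ^ i
    n≡ : n ≡ r + high * k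
    n≡ = trans (+-comm _ r) (cong (r +_) (trans (cong (x *_) (*-comm k (k ^ i))) (sym (*-assoc x (k ^ i) k))))
    1≤n : 1 ≤ n
    1≤n = ≤-trans (≤-trans 1≤x (m≤m*n x (k ^ suc i))) (m≤m+n _ r)
    quotient : n / k ≡ high + r / k
    quotient = begin
      n / k                ≡⟨ /-congˡ n≡ ⟩
      (r + high * k) / k   ≡⟨ +-distrib-/-∣ʳ r (divides high refl) ⟩
      r / k + high * k / k ≡⟨ cong (r / k +_) (m*n/n≡m high k) ⟩
      r / k + high         ≡⟨ +-comm (r / k) high ⟩
      high + r / k         ∎
    remainder : n % k ≡ r % k
    remainder = trans (cong (_% k) n≡) ([m+kn]%n≡m%n r high k)

  state-decompose : ∀ i n .{{_ : NonZero (k ^ i)}} → 1 ≤ n / k ^ i →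
                    state n ≡ runPadded (state (n / k ^ i)) i (n % k ^ i)
  state-decompose i n 1≤high = trans (cong state n≡) (state-append i 1≤high (m%n<n n (k ^ i)))
    where
    n≡ : n ≡ n / k ^ i * k ^ i + n % k ^ i
    n≡ = trans (m≡m%n+[m/n]*n n (k ^ i)) (+-comm (n % k ^ i) _)

  n/k^j<n/k^i : ∀ {i j} n .{{_ : NonZero (k ^ i)}} .{{_ : NonZero (k ^ j)}} →
                i < j → 1 ≤ n / k ^ i → n / k ^ j < n / k ^ i
  n/k^j<n/k^i {i} {j} n i<j 1≤n/k^i = begin-strict
      n / k ^ j
    ≤⟨ /-monoʳ-≤ n (^-monoʳ-≤ k i<j) ⟩
      n / k ^ suc i
    ≡⟨ /-congʳ (*-comm k (k ^ i)) ⟩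
      n / (k ^ i * k)
    ≡⟨ m/n/o≡m/[n*o] n (k ^ i) k ⟨
      n / k ^ i / k
    <⟨ m/n<m (n / k ^ i) k 1<k ⟩
      n / k ^ i
    ∎
    where
    open ≤-Reasoning
    instance
      _ = k^-nonZero (suc i)
      _ = m*n≢0 (k ^ i) k
      _ = >-nonZero 1≤n/k^i

  state-shorten : ∀ n → k ^ nStates ≤ n → ∃ λ n' → 1 ≤ n' × n' < n × state n' ≡ state n
  state-shorten n large
    with pigeonhole (n<1+n nStates) (λ i → let instance _ = k^-nonZero (toℕ i) in state (n / k ^ toℕ i))
  ... | i , j , i<j , same-state = n' , 1≤n' , n'<n , n'≈n
    where
    lo = toℕ i
    hi = toℕ j
    instance
      _ = k^-nonZero lo
      _ = k^-nonZero hi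
    1≤n/k^hi : 1 ≤ n / k ^ hi
    1≤n/k^hi = m≥n⇒m/n>0 (≤-trans (^-monoʳ-≤ k (s≤s⁻¹ (toℕ<n j))) large)
    1≤n/k^lo : 1 ≤ n / k ^ lo
    1≤n/k^lo = ≤-trans 1≤n/k^hi (/-monoʳ-≤ n (^-monoʳ-≤ k (<⇒≤ i<j)))
    n' = n / k ^ hi * k ^ lo + n % k ^ lo
    1≤n' : 1 ≤ n'
    1≤n' = ≤-trans (≤-trans 1≤n/k^hi (m≤m*n _ (k ^ lo))) (m≤m+n _ _)
    n'<n : n' < n
    n'<n = begin-strict
      n / k ^ hi * k ^ lo + n % k ^ lo  <⟨ +-monoˡ-< (n % k ^ lo) (*-monoˡ-< (k ^ lo) (n/k^j<n/k^i n i<j 1≤n/k^lo)) ⟩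
      n / k ^ lo * k ^ lo + n % k ^ lo  ≡⟨ +-comm (n / k ^ lo * k ^ lo) _ ⟩
      n % k ^ lo + n / k ^ lo * k ^ lo  ≡⟨ m≡m%n+[m/n]*n n (k ^ lo) ⟨
      n                                 ∎
      where open ≤-Reasoning
    n'≈n : state n' ≡ state n
    n'≈n = begin
      state n'                                       ≡⟨ state-append lo 1≤n/k^hi (m%n<n n (k ^ lo)) ⟩
      runPadded (state (n / k ^ hi)) lo (n % k ^ lo) ≡⟨ cong (λ q → runPadded q lo (n % k ^ lo)) same-state ⟨
      runPadded (state (n / k ^ lo)) lo (n % k ^ lo) ≡⟨ state-decompose lo n 1≤n/k^lo ⟨
      state n                                        ∎
      where open ≡-Reasoning

  state-representative : ∀ n → 1 ≤ n → ∃ λ n' → 1 ≤ n' × n' < k ^ nStates × state n' ≡ state n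
  state-representative = <-rec _ representative
    where
    representative : ∀ n → (∀ {m} → m < n → 1 ≤ m → ∃ λ n' → 1 ≤ n' × n' < k ^ nStates × state n' ≡ state m) →
                     1 ≤ n → ∃ λ n' → 1 ≤ n' × n' < k ^ nStates × state n' ≡ state n
    representative n shorter 1≤n with n <? k ^ nStates
    ... | yes small = n , 1≤n , small , refl
    ... | no ¬small =
      let (m , 1≤m , m<n , m≈n) = state-shorten n (≮⇒≥ ¬small)
          (n' , 1≤n' , small , n'≈m) = shorter m<n 1≤m
      in n' , 1≤n' , small , trans n'≈m m≈n

  blocksAmongFirst : ∀ j → BlocksAmongFirst (runDFAO b D) (k ^ nStates) (k ^ j)
  blocksAmongFirst j zero = zero , m^n>0 k nStates , λ _ _ → refl
  blocksAmongFirst j (suc x) =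
    let (x' , 1≤x' , x'<P , x'≈x) = state-representative (suc x) (s≤s z≤n)
    in x' , x'<P , λ r r<K → cong τ (begin
      state (suc x * k ^ j + r)     ≡⟨ state-append j {suc x} (s≤s z≤n) r<K ⟩
      runPadded (state (suc x)) j r ≡⟨ cong (λ q → runPadded q j r) x'≈x ⟨
      runPadded (state x') j r      ≡⟨ state-append j 1≤x' r<K ⟨
      state (x' * k ^ j + r)        ∎)
    where open ≡-Reasoning

automatic⇒blocksAmongFirst : {A : Set} {a : ℕ → A} → Automatic a →
                             ∃ λ P → ∀ n → ∃ λ K → n < K × BlocksAmongFirst a P K
automatic⇒blocksAmongFirst (b , D , a≡run) =
  k ^ nStates , λ n → k ^ n , n<m^n 1<k n , λ x →
    let (x' , x'<P , same) = blocksAmongFirst n x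
    in x' , x'<P , λ r r<K → trans (a≡run _) (trans (same r r<K) (sym (a≡run _)))
  where
  open AutomatonState b D
  open DFAO D using (nStates)

lemma3p7 : {A : Set} (_≟_ : DecidableEquality A) (a : ℕ → A) (α : A) →
    Automatic a → DensityZero _≟_ a α → UpperBanachDensityZero _≟_ a α
lemma3p7 _≟_ a α automatic dense m =
  let (P , blocks)         = automatic⇒blocksAmongFirst automatic
      (N₀ , dense-from-N₀) = dense (2 * suc m * P)
      (K , N₀<K , among)   = blocks N₀
      instance _ = >-nonZero (≤-<-trans z≤n N₀<K)
  in 2 * K , count-window (count-alignedBlock among (<⇒≤ N₀<K) dense-from-N₀)
  where open Counting _≟_ a α
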